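{- Let $n\ge 1$ be an integer. Every set $A\subseteq\mathbb{Z}_{2^n}$ with $|A|=2^{n-1}+1$ satisfies $\mathrm{ST}(A)\ge 3\cdot 2^{n-1}$.
   Context: $\mathbb{Z}_{2^n}$ is the cyclic group of integers modulo $2^n$. For $A\subseteq \mathbb{Z}_{2^n}$, the number of Schur triples in $A$ is $\mathrm{ST}(A)=|\{(x,y,z)\in A^3: x+y=z\}|$, where addition is modulo $2^n$ and ordered triples are counted (so $(x,y,z)$ and $(y,x,z)$ are counted separately when $x\ne y$). -}

module Defs where

open import Data.Nat using (ℕ; suc; _+_; _^_; NonZero)
open import Data.Nat.Properties using (m^n≢0)
open import Data.Nat.DivMod using (_mod_)
open import Data.Fin using (Fin; toℕ)
open import Data.Fin.Subset using (Subset; _∈_)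
open import Data.Fin.Subset.Properties using (_∈?_)
open import Data.List using (List; allFin; filter; length; cartesianProduct)
open import Data.Product using (_×_; _,_; proj₁; proj₂)
open import Relation.Nullary using (Dec; _×-dec_)
open import Relation.Binary.PropositionalEquality using (_≡_)
import Data.Fin as Fin

Z2^ : ℕ → Set
Z2^ n = Fin (2 ^ n)

addMod : (n : ℕ) → Z2^ n → Z2^ n → Z2^ n
addMod n x y = _mod_ (toℕ x + toℕ y) (2 ^ n) {{m^n≢0 2 n}}

IsSchurTriple : (n : ℕ) → Subset (2 ^ n) → Z2^ n × (Z2^ n × Z2^ n) → Set
IsSchurTriple n A (x , (y , z)) = (x ∈ A) × ((y ∈ A) × ((z ∈ A) × (addMod n x y ≡ z)))

isSchurTriple? : (n : ℕ) (A : Subset (2 ^ n)) (t : Z2^ n × (Z2^ n × Z2^ n)) → Dec (IsSchurTriple n A t)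
isSchurTriple? n A (x , (y , z)) = (x ∈? A) ×-dec ((y ∈? A) ×-dec ((z ∈? A) ×-dec (addMod n x y Fin.≟ z)))

triples : (n : ℕ) → List (Z2^ n × (Z2^ n × Z2^ n))
triples n = cartesianProduct (allFin (2 ^ n)) (cartesianProduct (allFin (2 ^ n)) (allFin (2 ^ n)))

ST : (n : ℕ) → Subset (2 ^ n) → ℕ
ST n A = length (filter (isSchurTriple? n A) (triples n))

module Submission where

-- Write N = 2^(m+1), M = 2^m and let A ⊆ Z_N have |A| = M + 1, so its
-- complement Aᶜ has M - 1 elements.  For x ∈ Z_N let r x (resp. s x) count the
-- y with y, x + y both in A (resp. both in Aᶜ).  Splitting the y ∈ A and the
-- translates x + y by membership gives r x = s x + |A| - |Aᶜ| = s x + 2, hence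
--   ST(A) = Σ_{x ∈ A} r x = 2|A| + D,   D = #{(x , y) : x ∈ A, y ∉ A, x + y ∉ A}.
-- Counting D by y, every y ≠ 0 contributes at least once: otherwise A + y ⊆ A,
-- so A is closed under the subgroup generated by y, which contains the element
-- M of order two; then A is a union of cosets {x , x + M} and |A| would be
-- even, while M + 1 is odd (for m ≥ 1).  Thus D ≥ |Aᶜ| - 1 = M - 2 and
-- ST(A) ≥ 2(M + 1) + M - 2 = 3M.

open import Defs
open import Data.Nat using (ℕ; _+_; _*_; _^_; _∸_; _≤_; _≥_)
open import Data.Fin.Subset using (Subset; ∣_∣)
open import Relation.Binary.PropositionalEquality using (_≡_)

open import Function using (_∘_)
open import Data.Bool using (Bool; true; false; _∧_; not)
open import Data.Bool.Properties using (∧-assoc; ∧-identityʳ; ∧-zeroʳ)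
open import Data.Empty using (⊥-elim)
open import Data.Product using (_×_; _,_; ∃-syntax)
open import Data.Sum using (_⊎_; inj₁; inj₂)
open import Data.Nat
  using (zero; suc; NonZero; _<_; _≟_; _<?_; z≤n; s≤s; z<s; s<s)
open import Data.Nat.Properties
open import Data.Nat.DivMod
  using (_%_; _mod_; [m+n]%n≡m%n; %-distribˡ-+; m%n%n≡m%n; m%n<n; m*n%n≡0;
         m<n⇒m%n≡m; m≤n⇒[n∸m]%m≡n%m)
open import Data.Nat.ListAction using (sum)
open import Data.Nat.ListAction.Properties using (sum-++)
open import Data.Nat.Tactic.RingSolver using (solve-∀)
open import Data.Fin using (Fin; toℕ)
import Data.Fin as Fin
open import Data.Fin.Properties using (toℕ-injective; toℕ-fromℕ<; toℕ<n)
open import Data.Fin.Subset using (inside; outside)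
open import Data.Fin.Subset.Properties using (_∈?_)
open import Data.List using (List; []; _∷_; _++_; map; tabulate; allFin; filter; length; cartesianProduct)
open import Data.List.Properties using (map-++; map-∘; map-cong; map-tabulate; tabulate-cong)
open import Data.Vec using ([]; _∷_)
open import Relation.Nullary using (¬_; does; yes; no; contradiction)
open import Relation.Unary using (Decidable)
open import Relation.Binary.PropositionalEquality
  using (refl; sym; trans; cong; cong₂; subst; _≢_; module ≡-Reasoning)
open import Algebra.Properties.CommutativeSemigroup +-commutativeSemigroup
  using (interchange) renaming (x∙yz≈y∙xz to x+[y+z]≡y+[x+z])
open import Algebra.Properties.CommutativeSemigroup *-commutativeSemigroup
  using () renaming (x∙yz≈y∙xz to x*[y*z]≡y*[x*z])

∑ : ℕ → (ℕ → ℕ) → ℕ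
∑ zero    f = 0
∑ (suc L) f = f 0 + ∑ L (f ∘ suc)

infix 6.5 ∑
syntax ∑ L (λ i → e) = ∑[ i < L ] e

∑-cong : ∀ L {f g : ℕ → ℕ} → (∀ i → f i ≡ g i) → ∑ L f ≡ ∑ L g
∑-cong zero    eq = refl
∑-cong (suc L) eq = cong₂ _+_ (eq 0) (∑-cong L (eq ∘ suc))

∑-mono-≤ : ∀ L {f g : ℕ → ℕ} → (∀ i → i < L → f i ≤ g i) → ∑ L f ≤ ∑ L g
∑-mono-≤ zero    le = z≤n
∑-mono-≤ (suc L) le = +-mono-≤ (le 0 z<s) (∑-mono-≤ L (λ i i<L → le (suc i) (s<s i<L)))

∑-const : ∀ L c → ∑[ i < L ] c ≡ L * c
∑-const zero    c = refl
∑-const (suc L) c = cong (c +_) (∑-const L c)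

∑-distrib-+ : ∀ L (f g : ℕ → ℕ) → ∑[ i < L ] (f i + g i) ≡ ∑ L f + ∑ L g
∑-distrib-+ zero    f g = refl
∑-distrib-+ (suc L) f g =
  trans (cong (f 0 + g 0 +_) (∑-distrib-+ L (f ∘ suc) (g ∘ suc)))
        (interchange (f 0) (g 0) _ _)

∑-*ˡ : ∀ L c (f : ℕ → ℕ) → ∑[ i < L ] (c * f i) ≡ c * ∑ L f
∑-*ˡ zero    c f = sym (*-zeroʳ c)
∑-*ˡ (suc L) c f = trans (cong (c * f 0 +_) (∑-*ˡ L c (f ∘ suc))) (sym (*-distribˡ-+ c (f 0) _))

∑-split : ∀ L K (f : ℕ → ℕ) → ∑ (L + K) f ≡ ∑ L f + ∑[ i < K ] f (L + i)
∑-split zero    K f = refl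
∑-split (suc L) K f = trans (cong (f 0 +_) (∑-split L K (f ∘ suc))) (sym (+-assoc (f 0) _ _))

∑-last : ∀ L (f : ℕ → ℕ) → ∑ (suc L) f ≡ ∑ L f + f L
∑-last zero    f = +-comm (f 0) 0
∑-last (suc L) f = trans (cong (f 0 +_) (∑-last L (f ∘ suc))) (sym (+-assoc (f 0) _ _))

∑-comm : ∀ L K (f : ℕ → ℕ → ℕ) → ∑[ i < L ] ∑[ j < K ] f i j ≡ ∑[ j < K ] ∑[ i < L ] f i j
∑-comm zero    K f = sym (trans (∑-const K 0) (*-zeroʳ K))
∑-comm (suc L) K f =
  trans (cong (∑ K (f 0) +_) (∑-comm L K (f ∘ suc))) (sym (∑-distrib-+ K (f 0) _))

∑≡0⇒term≡0 : ∀ L (f : ℕ → ℕ) → ∑ L f ≡ 0 → ∀ i → i < L → f i ≡ 0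
∑≡0⇒term≡0 (suc L) f eq zero    _         = m+n≡0⇒m≡0 (f 0) eq
∑≡0⇒term≡0 (suc L) f eq (suc i) (s<s i<L) = ∑≡0⇒term≡0 L (f ∘ suc) (m+n≡0⇒n≡0 (f 0) eq) i i<L

∑-periodic-shift : ∀ L (f : ℕ → ℕ) → (∀ i → f (i + L) ≡ f i) →
                   ∀ x → ∑[ y < L ] f (x + y) ≡ ∑ L f
∑-periodic-shift L f periodic zero    = refl
∑-periodic-shift L f periodic (suc x) = begin
  ∑[ y < L ] f (suc x + y)     ≡⟨ ∑-cong L (λ y → cong f (sym (+-suc x y))) ⟩
  ∑[ y < L ] g (suc y)         ≡⟨ shift-by-one ⟩
  ∑ L g                        ≡⟨ ∑-periodic-shift L f periodic x ⟩
  ∑ L f                        ∎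
  where
  open ≡-Reasoning
  g : ℕ → ℕ
  g y = f (x + y)
  g-wraps : g L ≡ g 0
  g-wraps = trans (periodic x) (cong f (sym (+-identityʳ x)))
  shift-by-one : ∑[ y < L ] g (suc y) ≡ ∑ L g
  shift-by-one = +-cancelˡ-≡ (g 0) _ _
    (trans (∑-last L g) (trans (cong (∑ L g +_) g-wraps) (+-comm (∑ L g) (g 0))))

∑-dominated-off-zero : ∀ L (f g : ℕ → ℕ) → f 0 ≤ 1 → (∀ i → 0 < i → i < L → f i ≤ g i) →
                       ∑ L f ≤ suc (∑ L g)
∑-dominated-off-zero zero    f g f0≤1 le = z≤n
∑-dominated-off-zero (suc L) f g f0≤1 le = +-mono-≤ f0≤1 (begin
  ∑[ i < L ] f (suc i)         ≤⟨ ∑-mono-≤ L (λ i i<L → le (suc i) z<s (s<s i<L)) ⟩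
  ∑[ i < L ] g (suc i)         ≤⟨ m≤n+m _ (g 0) ⟩
  g 0 + ∑[ i < L ] g (suc i)   ∎)
  where open ≤-Reasoning

bit : Bool → ℕ
bit true  = 1
bit false = 0

bit-∧ : ∀ p q → bit (p ∧ q) ≡ bit p * bit q
bit-∧ true  q = sym (+-identityʳ (bit q))
bit-∧ false q = refl

bit+bit-not : ∀ p → bit p + bit (not p) ≡ 1
bit+bit-not true  = refl
bit+bit-not false = refl

bit-product-vanishes : ∀ {p} q → p ≡ true → bit p * bit (not q) ≡ 0 → q ≡ true
bit-product-vanishes true  _    _  = refl
bit-product-vanishes false refl ()

-- Counting in an N-periodic subset of ℕ, i.e. a subset A of Z_N.

module PeriodicSet (N : ℕ) .{{_ : NonZero N}} (a : ℕ → Bool)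
                   (periodic : ∀ i j → i % N ≡ j % N → a i ≡ a j) where

  χ ψ : ℕ → ℕ
  χ i = bit (a i)
  ψ i = bit (not (a i))

  χ+ψ : ∀ i → χ i + ψ i ≡ 1
  χ+ψ i = bit+bit-not (a i)

  a-periodic : ∀ i → a (i + N) ≡ a i
  a-periodic i = periodic (i + N) i ([m+n]%n≡m%n i N)

  #A #Aᶜ : ℕ
  #A  = ∑ N χ
  #Aᶜ = ∑ N ψ

  #A+#Aᶜ : #A + #Aᶜ ≡ N
  #A+#Aᶜ = begin
    #A + #Aᶜ            ≡⟨ sym (∑-distrib-+ N χ ψ) ⟩
    ∑[ i < N ] (χ i + ψ i) ≡⟨ ∑-cong N χ+ψ ⟩
    ∑[ i < N ] 1        ≡⟨ ∑-const N 1 ⟩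
    N * 1               ≡⟨ *-identityʳ N ⟩
    N                   ∎
    where open ≡-Reasoning

  r s t : ℕ → ℕ
  r x = ∑[ y < N ] χ y * χ (x + y)
  s x = ∑[ y < N ] ψ y * ψ (x + y)
  t x = ∑[ y < N ] χ y * ψ (x + y)

  r+t : ∀ x → r x + t x ≡ #A
  r+t x = trans (sym (∑-distrib-+ N _ _)) (∑-cong N λ y → begin
    χ y * χ (x + y) + χ y * ψ (x + y) ≡⟨ sym (*-distribˡ-+ (χ y) _ _) ⟩
    χ y * (χ (x + y) + ψ (x + y))     ≡⟨ cong (χ y *_) (χ+ψ (x + y)) ⟩
    χ y * 1                           ≡⟨ *-identityʳ (χ y) ⟩
    χ y                               ∎)
    where open ≡-Reasoning

  -- The translate x + Aᶜ has as many elements as Aᶜ.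
  s+t : ∀ x → s x + t x ≡ #Aᶜ
  s+t x = trans (sym (∑-distrib-+ N _ _)) (trans (∑-cong N split-ψ) ψ-translate)
    where
    split-ψ : ∀ y → ψ y * ψ (x + y) + χ y * ψ (x + y) ≡ ψ (x + y)
    split-ψ y = trans (sym (*-distribʳ-+ (ψ (x + y)) (ψ y) (χ y)))
                      (trans (cong (_* ψ (x + y)) (trans (+-comm (ψ y) (χ y)) (χ+ψ y)))
                             (+-identityʳ (ψ (x + y))))
    ψ-translate : ∑[ y < N ] ψ (x + y) ≡ #Aᶜ
    ψ-translate = ∑-periodic-shift N ψ (cong (bit ∘ not) ∘ a-periodic) x

  r-s-balance : ∀ x → r x + #Aᶜ ≡ s x + #A
  r-s-balance x = begin
    r x + #Aᶜ          ≡⟨ cong (r x +_) (sym (s+t x)) ⟩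
    r x + (s x + t x)  ≡⟨ x+[y+z]≡y+[x+z] (r x) (s x) (t x) ⟩
    s x + (r x + t x)  ≡⟨ cong (s x +_) (r+t x) ⟩
    s x + #A           ∎
    where open ≡-Reasoning

  T D : ℕ
  T = ∑[ x < N ] ∑[ y < N ] χ x * (χ y * χ (x + y))
  D = ∑[ x < N ] χ x * s x

  -- When |A| = |Aᶜ| + 2, every x has r x = s x + 2, so ST(A) = 2|A| + D.
  T≡2#A+D : #A ≡ 2 + #Aᶜ → T ≡ 2 * #A + D
  T≡2#A+D #A≡ = begin
    T                                   ≡⟨ ∑-cong N (λ x → ∑-*ˡ N (χ x) _) ⟩
    ∑[ x < N ] χ x * r x                 ≡⟨ ∑-cong N (λ x → cong (χ x *_) (r≡2+s x)) ⟩
    ∑[ x < N ] χ x * (2 + s x)           ≡⟨ ∑-cong N (λ x → *-distribˡ-+ (χ x) 2 (s x)) ⟩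
    ∑[ x < N ] (χ x * 2 + χ x * s x)     ≡⟨ ∑-distrib-+ N _ _ ⟩
    (∑[ x < N ] χ x * 2) + D             ≡⟨ cong (_+ D) (∑-cong N (λ x → *-comm (χ x) 2)) ⟩
    (∑[ x < N ] 2 * χ x) + D             ≡⟨ cong (_+ D) (∑-*ˡ N 2 χ) ⟩
    2 * #A + D                           ∎
    where
    open ≡-Reasoning
    r≡2+s : ∀ x → r x ≡ 2 + s x
    r≡2+s x = +-cancelʳ-≡ #Aᶜ (r x) (2 + s x)
      (trans (r-s-balance x) (trans (cong (s x +_) #A≡) (x+[y+z]≡y+[x+z] (s x) 2 #Aᶜ)))

  u : ℕ → ℕ
  u y = ∑[ x < N ] χ x * ψ (x + y)

  D≡∑ψu : D ≡ ∑[ y < N ] ψ y * u y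
  D≡∑ψu = begin
    ∑[ x < N ] χ x * s x                              ≡⟨ ∑-cong N (λ x → sym (∑-*ˡ N (χ x) _)) ⟩
    ∑[ x < N ] ∑[ y < N ] χ x * (ψ y * ψ (x + y))     ≡⟨ ∑-comm N N _ ⟩
    ∑[ y < N ] ∑[ x < N ] χ x * (ψ y * ψ (x + y))     ≡⟨ ∑-cong N (λ y → ∑-cong N (λ x →
                                                          x*[y*z]≡y*[x*z] (χ x) (ψ y) _)) ⟩
    ∑[ y < N ] ∑[ x < N ] ψ y * (χ x * ψ (x + y))     ≡⟨ ∑-cong N (λ y → ∑-*ˡ N (ψ y) _) ⟩
    ∑[ y < N ] ψ y * u y                              ∎
    where open ≡-Reasoning

  D-lower-bound : (∀ y → 0 < y → y < N → 1 ≤ u y) → #Aᶜ ≤ suc D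
  D-lower-bound u-positive = subst (#Aᶜ ≤_) (cong suc (sym D≡∑ψu))
    (∑-dominated-off-zero N ψ (λ y → ψ y * u y) (ψ≤1 0)
      (λ y 0<y y<N → ≤-trans (≤-reflexive (sym (*-identityʳ (ψ y))))
                             (*-monoʳ-≤ (ψ y) (u-positive y 0<y y<N))))
    where
    ψ≤1 : ∀ i → ψ i ≤ 1
    ψ≤1 i = m+n≤o⇒n≤o (χ i) (≤-reflexive (χ+ψ i))

  ClosedUnder : ℕ → Set
  ClosedUnder y = ∀ x → a x ≡ true → a (x + y) ≡ true

  u≡0⇒closed : ∀ y → u y ≡ 0 → ClosedUnder y
  u≡0⇒closed y u≡0 x x∈A = trans (periodic (x + y) (x % N + y) reduce) x%N+y∈A
    where
    reduce : (x + y) % N ≡ (x % N + y) % N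
    reduce = begin
      (x + y) % N                  ≡⟨ %-distribˡ-+ x y N ⟩
      (x % N + y % N) % N          ≡⟨ cong (λ v → (v + y % N) % N) (sym (m%n%n≡m%n x N)) ⟩
      (x % N % N + y % N) % N      ≡⟨ sym (%-distribˡ-+ (x % N) y N) ⟩
      (x % N + y) % N              ∎
      where open ≡-Reasoning
    x%N+y∈A : a (x % N + y) ≡ true
    x%N+y∈A = bit-product-vanishes (a (x % N + y))
      (trans (periodic (x % N) x (m%n%n≡m%n x N)) x∈A)
      (∑≡0⇒term≡0 N _ u≡0 (x % N) (m%n<n x N))

  closed-multiple : ∀ {y} → ClosedUnder y → ∀ k → ClosedUnder (k * y)
  closed-multiple closed zero    x x∈A = subst (λ v → a v ≡ true) (sym (+-identityʳ x)) x∈A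
  closed-multiple {y} closed (suc k) x x∈A =
    subst (λ v → a v ≡ true) (+-assoc x y (k * y)) (closed-multiple closed k (x + y) (closed x x∈A))

  closed-mod : ∀ {y z} → ClosedUnder y → y % N ≡ z % N → ClosedUnder z
  closed-mod {y} {z} closed y≡z x x∈A = trans (periodic (x + z) (x + y) same) (closed x x∈A)
    where
    same : (x + z) % N ≡ (x + y) % N
    same = trans (%-distribˡ-+ x z N)
                 (trans (cong (λ v → (x % N + v) % N) (sym y≡z)) (sym (%-distribˡ-+ x y N)))

  -- A set closed under the half period M is a union of pairs {x , x + M}.
  half-period-size : ∀ M → N ≡ M + M → ClosedUnder M → #A ≡ 2 * ∑ M χ
  half-period-size M N≡M+M closed = begin
    ∑ N χ                              ≡⟨ cong (λ L → ∑ L χ) N≡M+M ⟩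
    ∑ (M + M) χ                        ≡⟨ ∑-split M M χ ⟩
    ∑ M χ + ∑[ i < M ] χ (M + i)       ≡⟨ cong (∑ M χ +_) (∑-cong M (cong bit ∘ a-shift)) ⟩
    ∑ M χ + ∑ M χ                      ≡⟨ cong (∑ M χ +_) (sym (+-identityʳ (∑ M χ))) ⟩
    2 * ∑ M χ                          ∎
    where
    open ≡-Reasoning
    a-shift : ∀ i → a (M + i) ≡ a i
    a-shift i with a i in ai | a (M + i) in aMi
    ... | true  | true  = refl
    ... | false | false = refl
    ... | true  | false = trans (sym aMi) (subst (λ v → a v ≡ true) (+-comm i M) (closed i ai))
    ... | false | true  = sym (trans (sym ai) (trans (sym (a-periodic i))
                            (subst (λ v → a v ≡ true) two-steps (closed (M + i) aMi))))
      where
      two-steps : M + i + M ≡ i + N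
      two-steps = trans (+-comm (M + i) M) (trans (sym (+-assoc M M i))
                    (trans (+-comm (M + M) i) (cong (i +_) (sym N≡M+M))))

switch-on : (Q : ℕ → Set) → Decidable Q → ¬ Q 0 → ∀ K → Q K → ∃[ k ] (¬ Q k × Q (suc k))
switch-on Q Q? ¬Q0 zero    QK = ⊥-elim (¬Q0 QK)
switch-on Q Q? ¬Q0 (suc K) QK with Q? K
... | yes QK' = switch-on Q Q? ¬Q0 K QK'
... | no ¬QK  = K , ¬QK , QK

double-injective : ∀ {a b} → a + a ≡ b + b → a ≡ b
double-injective {a} {b} eq = *-cancelˡ-≡ a b 2
  (trans (cong (a +_) (+-identityʳ a)) (trans eq (cong (b +_) (sym (+-identityʳ b)))))

order-two : ∀ {N M r} .{{_ : NonZero N}} → N ≡ M + M → r ≢ 0 → r < N → (r + r) % N ≡ 0 → r ≡ M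
order-two {N} {M} {r} N≡M+M r≢0 r<N 2r≡0 with r + r <? N
... | yes 2r<N = ⊥-elim (r≢0 (m+n≡0⇒m≡0 r (trans (sym (m<n⇒m%n≡m 2r<N)) 2r≡0)))
... | no 2r≮N = double-injective (trans 2r≡N N≡M+M)
  where
  N≤2r : N ≤ r + r
  N≤2r = ≮⇒≥ 2r≮N
  2r∸N≡0 : r + r ∸ N ≡ 0
  2r∸N≡0 = trans (sym (m<n⇒m%n≡m (m<n+o⇒m∸n<o (r + r) N (+-mono-< r<N r<N))))
                 (trans (m≤n⇒[n∸m]%m≡n%m N≤2r) 2r≡0)
  2r≡N : r + r ≡ N
  2r≡N = ≤-antisym (m∸n≡0⇒m≤n 2r∸N≡0) N≤2r

-- Take k maximal with 2^k y ≢ 0 in Z_N; then 2^k y has order two, so equals 2^m.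
half-is-multiple : ∀ m .{{_ : NonZero (2 ^ suc m)}} y → 0 < y → y < 2 ^ suc m →
                   ∃[ k ] (k * y) % 2 ^ suc m ≡ 2 ^ m
half-is-multiple m y 0<y y<N = from-switch (switch-on Q Q? ¬Q0 (suc m) Q[m+1])
  where
  N : ℕ
  N = 2 ^ suc m
  Q : ℕ → Set
  Q k = (2 ^ k * y) % N ≡ 0
  Q? : Decidable Q
  Q? k = (2 ^ k * y) % N ≟ 0
  ¬Q0 : ¬ Q 0
  ¬Q0 Q0 = >⇒≢ 0<y (trans (sym (m<n⇒m%n≡m y<N)) (trans (cong (_% N) (sym (+-identityʳ y))) Q0))
  Q[m+1] : Q (suc m)
  Q[m+1] = trans (cong (_% N) (*-comm N y)) (m*n%n≡0 y N)
  from-switch : ∃[ k ] (¬ Q k × Q (suc k)) → ∃[ k ] (k * y) % N ≡ 2 ^ m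
  from-switch (k , ¬Qk , Q[k+1]) = 2 ^ k , order-two N≡M+M ¬Qk (m%n<n z N) doubled
    where
    z : ℕ
    z = 2 ^ k * y
    N≡M+M : N ≡ 2 ^ m + 2 ^ m
    N≡M+M = cong (2 ^ m +_) (+-identityʳ (2 ^ m))
    z+z : 2 ^ suc k * y ≡ z + z
    z+z = trans (*-assoc 2 (2 ^ k) y) (cong (z +_) (+-identityʳ z))
    doubled : (z % N + z % N) % N ≡ 0
    doubled = trans (sym (%-distribˡ-+ z z N)) (trans (cong (_% N) (sym z+z)) Q[k+1])

2^m-one-or-even : ∀ m → 2 ^ m ≡ 1 ⊎ ∃[ c ] 2 ^ m ≡ 2 * c
2^m-one-or-even zero    = inj₁ refl
2^m-one-or-even (suc m) = inj₂ (2 ^ m , refl)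

module SchurBound (m : ℕ) .{{_ : NonZero (2 ^ suc m)}} (a : ℕ → Bool)
                  (periodic : ∀ i j → i % 2 ^ suc m ≡ j % 2 ^ suc m → a i ≡ a j) where

  N M : ℕ
  N = 2 ^ suc m
  M = 2 ^ m

  open PeriodicSet N a periodic

  N≡M+M : N ≡ M + M
  N≡M+M = cong (M +_) (+-identityʳ M)

  odd⇒u-positive : (∀ c → #A ≢ 2 * c) → ∀ y → 0 < y → y < N → 1 ≤ u y
  odd⇒u-positive odd y 0<y y<N with u y ≟ 0
  ... | no  u≢0 = n≢0⇒n>0 u≢0
  ... | yes u≡0 with half-is-multiple m y 0<y y<N
  ...   | k , ky≡M = contradiction (half-period-size M N≡M+M closed-M) (odd (∑ M χ))
    where
    M<N : M < N
    M<N = subst (M <_) (sym N≡M+M) (m<m+n M (m^n>0 2 m))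
    closed-M : ClosedUnder M
    closed-M = closed-mod (closed-multiple (u≡0⇒closed y u≡0) k)
                          (trans ky≡M (sym (m<n⇒m%n≡m M<N)))

  -- ST(A) = 2(M + 1) + D with D ≥ |Aᶜ| - 1 = M - 2; for M = 1 already 2(M + 1) ≥ 3M.
  schur-bound : #A ≡ suc M → 3 * M ≤ T
  schur-bound #A≡ = begin
    3 * M              ≡⟨⟩
    M + 2 * M          ≤⟨ +-monoˡ-≤ (2 * M) M≤2+D ⟩
    2 + D + 2 * M      ≡⟨ rearrange M D ⟩
    2 * suc M + D      ≡⟨ sym (trans (T≡2#A+D #A≡2+#Aᶜ) (cong (λ v → 2 * v + D) #A≡)) ⟩
    T                  ∎
    where
    open ≤-Reasoning
    rearrange : ∀ M D → 2 + D + 2 * M ≡ 2 * suc M + D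
    rearrange = solve-∀
    suc#Aᶜ≡M : suc #Aᶜ ≡ M
    suc#Aᶜ≡M = +-cancelˡ-≡ M _ _
      (trans (+-suc M #Aᶜ) (trans (cong (_+ #Aᶜ) (sym #A≡)) (trans #A+#Aᶜ N≡M+M)))
    #A≡2+#Aᶜ : #A ≡ 2 + #Aᶜ
    #A≡2+#Aᶜ = trans #A≡ (cong suc (sym suc#Aᶜ≡M))
    M≤2+D : M ≤ 2 + D
    M≤2+D with 2^m-one-or-even m
    ... | inj₁ M≡1       = subst (_≤ 2 + D) (sym M≡1) (s≤s z≤n)
    ... | inj₂ (c , M≡2c) = subst (_≤ 2 + D) suc#Aᶜ≡M (s≤s (D-lower-bound (odd⇒u-positive odd)))
      where
      odd : ∀ c′ → #A ≢ 2 * c′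
      odd c′ #A≡2c′ = even≢odd c′ c (trans (sym #A≡2c′) (trans #A≡ (cong suc M≡2c)))

length-filter≡sum : ∀ {a p} {X : Set a} {P : X → Set p} (P? : Decidable P) (xs : List X) →
                    length (filter P? xs) ≡ sum (map (bit ∘ does ∘ P?) xs)
length-filter≡sum P? []       = refl
length-filter≡sum P? (x ∷ xs) with does (P? x)
... | true  = cong suc (length-filter≡sum P? xs)
... | false = length-filter≡sum P? xs

sum-map-cong : ∀ {a} {X : Set a} {f g : X → ℕ} → (∀ x → f x ≡ g x) → (xs : List X) →
               sum (map f xs) ≡ sum (map g xs)
sum-map-cong eq xs = cong sum (map-cong eq xs)

sum-cartesianProduct : ∀ {a b} {X : Set a} {Y : Set b} (f : X × Y → ℕ) (xs : List X) (ys : List Y) →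
  sum (map f (cartesianProduct xs ys)) ≡ sum (map (λ x → sum (map (λ y → f (x , y)) ys)) xs)
sum-cartesianProduct f []       ys = refl
sum-cartesianProduct f (x ∷ xs) ys = begin
  sum (map f (map (x ,_) ys ++ cartesianProduct xs ys))
    ≡⟨ cong sum (map-++ f (map (x ,_) ys) _) ⟩
  sum (map f (map (x ,_) ys) ++ map f (cartesianProduct xs ys))
    ≡⟨ sum-++ (map f (map (x ,_) ys)) _ ⟩
  sum (map f (map (x ,_) ys)) + sum (map f (cartesianProduct xs ys))
    ≡⟨ cong₂ _+_ (cong sum (sym (map-∘ ys))) (sum-cartesianProduct f xs ys) ⟩
  sum (map (λ y → f (x , y)) ys) + sum (map (λ x → sum (map (λ y → f (x , y)) ys)) xs) ∎
  where open ≡-Reasoning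

sum-tabulate-toℕ : ∀ L (g : ℕ → ℕ) → sum (tabulate {n = L} (g ∘ toℕ)) ≡ ∑ L g
sum-tabulate-toℕ zero    g = refl
sum-tabulate-toℕ (suc L) g = cong (g 0 +_) (sum-tabulate-toℕ L (g ∘ suc))

sum-allFin : ∀ L (g : ℕ → ℕ) → sum (map (g ∘ toℕ) (allFin L)) ≡ ∑ L g
sum-allFin L g = trans (cong sum (map-tabulate {n = L} (λ i → i) (g ∘ toℕ))) (sum-tabulate-toℕ L g)

sum-tabulate-point : ∀ L (p : Fin L → Bool) (w : Fin L) →
                     sum (tabulate (λ z → bit (p z ∧ does (w Fin.≟ z)))) ≡ bit (p w)
sum-tabulate-point (suc L) p Fin.zero = trans
  (cong₂ _+_ (cong bit (∧-identityʳ (p Fin.zero))) (no-hits L (p ∘ Fin.suc)))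
  (+-identityʳ (bit (p Fin.zero)))
  where
  no-hits : ∀ L (q : Fin L → Bool) → sum (tabulate (λ z → bit (q z ∧ false))) ≡ 0
  no-hits zero    q = refl
  no-hits (suc L) q = cong₂ _+_ (cong bit (∧-zeroʳ (q Fin.zero))) (no-hits L (q ∘ Fin.suc))
sum-tabulate-point (suc L) p (Fin.suc w) =
  cong₂ _+_ (cong bit (∧-zeroʳ (p Fin.zero))) (sum-tabulate-point L (p ∘ Fin.suc) w)

sum-allFin-point : ∀ L (p : Fin L → Bool) (w : Fin L) →
                   sum (map (λ z → bit (p z ∧ does (w Fin.≟ z))) (allFin L)) ≡ bit (p w)
sum-allFin-point L p w = trans (cong sum (map-tabulate {n = L} (λ i → i) _)) (sum-tabulate-point L p w)

card≡sum : ∀ L (A : Subset L) → ∣ A ∣ ≡ sum (tabulate (λ i → bit (does (i ∈? A))))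
card≡sum zero    []            = refl
card≡sum (suc L) (inside  ∷ A) = cong suc (card≡sum L A)
card≡sum (suc L) (outside ∷ A) = card≡sum L A

-- Regrouping the four conditions of a Schur triple to isolate z = x + y.
∧-regroup : ∀ p q r s → p ∧ (q ∧ (r ∧ s)) ≡ (p ∧ (q ∧ r)) ∧ s
∧-regroup p q r s = sym (trans (∧-assoc p (q ∧ r) s) (cong (p ∧_) (∧-assoc q r s)))

module FromSubset (n : ℕ) .{{_ : NonZero (2 ^ n)}} (A : Subset (2 ^ n)) where

  inA : ℕ → Bool
  inA i = does ((i mod 2 ^ n) ∈? A)

  inA-periodic : ∀ i j → i % 2 ^ n ≡ j % 2 ^ n → inA i ≡ inA j
  inA-periodic i j eq = cong (λ v → does (v ∈? A))
    (toℕ-injective (trans (toℕ-fromℕ< _) (trans eq (sym (toℕ-fromℕ< _)))))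

  inA-toℕ : (x : Fin (2 ^ n)) → does (x ∈? A) ≡ inA (toℕ x)
  inA-toℕ x = cong (λ v → does (v ∈? A))
    (sym (toℕ-injective (trans (toℕ-fromℕ< _) (m<n⇒m%n≡m (toℕ<n x)))))

  open PeriodicSet (2 ^ n) inA inA-periodic

  card≡#A : ∣ A ∣ ≡ #A
  card≡#A = trans (card≡sum (2 ^ n) A)
    (trans (cong sum (tabulate-cong (cong bit ∘ inA-toℕ))) (sum-tabulate-toℕ (2 ^ n) χ))

  Fs : List (Fin (2 ^ n))
  Fs = allFin (2 ^ n)

  indicator : Fin (2 ^ n) × (Fin (2 ^ n) × Fin (2 ^ n)) → ℕ
  indicator = bit ∘ does ∘ isSchurTriple? n A

  -- For fixed x, y exactly one z = x + y can complete a Schur triple.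
  fiber : ∀ x y → sum (map (λ z → indicator (x , (y , z))) Fs)
                  ≡ χ (toℕ x) * (χ (toℕ y) * χ (toℕ x + toℕ y))
  fiber x y = begin
    sum (map (λ z → indicator (x , (y , z))) Fs)
      ≡⟨ sum-map-cong (λ z → cong bit (∧-regroup px py (p z) _)) Fs ⟩
    sum (map (λ z → bit ((px ∧ (py ∧ p z)) ∧ does (addMod n x y Fin.≟ z))) Fs)
      ≡⟨ sum-allFin-point (2 ^ n) (λ z → px ∧ (py ∧ p z)) (addMod n x y) ⟩
    bit (px ∧ (py ∧ p (addMod n x y)))
      ≡⟨ trans (bit-∧ px _) (cong (bit px *_) (bit-∧ py _)) ⟩
    bit px * (bit py * χ (toℕ x + toℕ y))
      ≡⟨ cong₂ (λ u v → bit u * (bit v * χ (toℕ x + toℕ y))) (inA-toℕ x) (inA-toℕ y) ⟩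
    χ (toℕ x) * (χ (toℕ y) * χ (toℕ x + toℕ y)) ∎
    where
    open ≡-Reasoning
    p : Fin (2 ^ n) → Bool
    p z = does (z ∈? A)
    px py : Bool
    px = p x
    py = p y

  ST≡T : ST n A ≡ T
  ST≡T = begin
    ST n A
      ≡⟨ length-filter≡sum (isSchurTriple? n A) (triples n) ⟩
    sum (map indicator (cartesianProduct Fs (cartesianProduct Fs Fs)))
      ≡⟨ sum-cartesianProduct indicator Fs _ ⟩
    sum (map (λ x → sum (map (λ yz → indicator (x , yz)) (cartesianProduct Fs Fs))) Fs)
      ≡⟨ sum-map-cong (λ x → sum-cartesianProduct _ Fs Fs) Fs ⟩
    sum (map (λ x → sum (map (λ y → sum (map (λ z → indicator (x , (y , z))) Fs)) Fs)) Fs)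
      ≡⟨ sum-map-cong (λ x → sum-map-cong (fiber x) Fs) Fs ⟩
    sum (map (λ x → sum (map (λ y → χ (toℕ x) * (χ (toℕ y) * χ (toℕ x + toℕ y))) Fs)) Fs)
      ≡⟨ sum-map-cong (λ x → sum-allFin (2 ^ n) (λ y → χ (toℕ x) * (χ y * χ (toℕ x + y)))) Fs ⟩
    sum (map (λ x → ∑[ y < 2 ^ n ] χ (toℕ x) * (χ y * χ (toℕ x + y))) Fs)
      ≡⟨ sum-allFin (2 ^ n) (λ x → ∑[ y < 2 ^ n ] χ x * (χ y * χ (x + y))) ⟩
    T ∎
    where open ≡-Reasoning

theorem1p8 : (n : ℕ) → n ≥ 1 → (A : Subset (2 ^ n)) →
    ∣ A ∣ ≡ 2 ^ (n ∸ 1) + 1 → ST n A ≥ 3 * 2 ^ (n ∸ 1)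
theorem1p8 (suc m) _ A |A|≡ = subst (3 * 2 ^ m ≤_) (sym ST≡T) (schur-bound #A≡)
  where
  instance
    2^[m+1]≢0 : NonZero (2 ^ suc m)
    2^[m+1]≢0 = m^n≢0 2 (suc m)
  open FromSubset (suc m) A using (inA; inA-periodic; card≡#A; ST≡T)
  open PeriodicSet (2 ^ suc m) inA inA-periodic using (#A)
  open SchurBound m inA inA-periodic using (schur-bound)
  #A≡ : #A ≡ suc (2 ^ m)
  #A≡ = trans (sym card≡#A) (trans |A|≡ (+-comm (2 ^ m) 1))
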